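{- Let $t(n)=(-1)^{s_2(n)}$ for $n\ge 0$, where $s_2(n)$ is the sum of the binary digits of $n$, and let $T(n;x)=\sum_{m=0}^{n-1}t(m)x^m$. Let $r\ge 1$ be odd, let $\omega$ be an $r$th root of unity (not necessarily primitive), and let $s\ge 1$ be an integer with $2^s\equiv 1 \pmod r$. Then for all integers $n\ge 1$, $$T(2^s n;\omega)=T(2^s;\omega)\,T(n;\omega).$$
   Context: $\{t(n)\}_{n\ge0}$ is the Thue--Morse sequence with values $\pm1$, equivalently defined by $t(0)=1$, $t(2n)=t(n)$, $t(2n+1)=-t(n)$. -}

module Defs where

open import Level using (Level)
open import Data.Nat using (ℕ; zero; suc; _%_; _/_)
import Data.Nat as ℕ
open import Algebra.Bundles using (CommutativeRing)

-- s₂ n = sum of the binary digits of n.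
-- Computed with fuel: fuel n suffices since each step halves n.
digitSumFuel : ℕ → ℕ → ℕ
digitSumFuel zero    n = 0
digitSumFuel (suc k) n = n % 2 ℕ.+ digitSumFuel k (n / 2)

s₂ : ℕ → ℕ
s₂ n = digitSumFuel n n

module _ {c ℓ : Level} (R : CommutativeRing c ℓ) where
  open CommutativeRing R

  pow : Carrier → ℕ → Carrier
  pow x zero    = 1#
  pow x (suc k) = x * pow x k

  tm : ℕ → Carrier
  tm n = pow (- 1#) (s₂ n)

  T : ℕ → Carrier → Carrier
  T zero    x = 0#
  T (suc n) x = T n x + tm n * pow x n

-- Since t(2m) = t(m) and t(2m+1) = -t(m), pairing the terms of index 2m and 2m+1
-- gives T(2m; x) = (1 - x) T(m; x²) for every x; iterating s times yields
-- T(2ˢ m; x) = T(2ˢ; x) T(m; x^(2ˢ)).  If ωʳ = 1 and r ∣ 2ˢ - 1 then ω^(2ˢ) = ω.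
module Submission where

open import Defs
open import Level using (Level)
open import Data.Nat using (ℕ; _^_; _∸_; _%_; _≥_)
import Data.Nat as ℕ
open import Data.Nat.Divisibility using (_∣_)
open import Relation.Binary.PropositionalEquality using (_≡_)
open import Algebra.Bundles using (CommutativeRing)

open import Data.Nat using (zero; suc; _/_; _≤_; _≤′_; ≤′-refl; ≤′-step; z≤n; s≤s)
import Data.Nat.Properties as ℕₚ
open import Data.Nat.DivMod using (m/n<m; m*n%n≡0; m*n/n≡m; [m+kn]%n≡m%n; +-distrib-/-∣ʳ)
open import Data.Nat.Divisibility using (divides; n∣m*n)
import Relation.Binary.PropositionalEquality as ≡
open import Data.Maybe using (nothing)
import Tactic.RingSolver.Core.AlmostCommutativeRing as ACR
import Algebra.Properties.CommutativeSemiring.Exp as Exp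

n≤1+f⇒n/2≤f : ∀ {n f} → n ≤ suc f → n / 2 ≤ f
n≤1+f⇒n/2≤f {zero}  _     = z≤n
n≤1+f⇒n/2≤f {suc n} n≤1+f = ℕₚ.≤-pred (ℕₚ.≤-trans (m/n<m (suc n) 2 (s≤s (s≤s z≤n))) n≤1+f)

digitSumFuel-suc : ∀ f {n} → n ≤ f → digitSumFuel (suc f) n ≡ digitSumFuel f n
digitSumFuel-suc zero    z≤n         = ≡.refl
digitSumFuel-suc (suc f) {n} n≤1+f = ≡.cong (n % 2 ℕ.+_) (digitSumFuel-suc f (n≤1+f⇒n/2≤f n≤1+f))

digitSumFuel-stable : ∀ {f n} → n ≤′ f → digitSumFuel f n ≡ s₂ n
digitSumFuel-stable ≤′-refl        = ≡.refl
digitSumFuel-stable (≤′-step n≤′f) =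
  ≡.trans (digitSumFuel-suc _ (ℕₚ.≤′⇒≤ n≤′f)) (digitSumFuel-stable n≤′f)

s₂-step : ∀ n → s₂ n ≡ n % 2 ℕ.+ s₂ (n / 2)
s₂-step zero    = ≡.refl
s₂-step (suc n) =
  ≡.cong (suc n % 2 ℕ.+_) (digitSumFuel-stable (ℕₚ.≤⇒≤′ (n≤1+f⇒n/2≤f {suc n} {n} ℕₚ.≤-refl)))

s₂-double : ∀ m → s₂ (2 ℕ.* m) ≡ s₂ m
s₂-double m = begin
  s₂ (2 ℕ.* m)                      ≡⟨ ≡.cong s₂ (ℕₚ.*-comm 2 m) ⟩
  s₂ (m ℕ.* 2)                      ≡⟨ s₂-step (m ℕ.* 2) ⟩
  m ℕ.* 2 % 2 ℕ.+ s₂ (m ℕ.* 2 / 2)  ≡⟨ ≡.cong₂ (λ b q → b ℕ.+ s₂ q) (m*n%n≡0 m 2) (m*n/n≡m m 2) ⟩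
  s₂ m                              ∎
  where open ≡.≡-Reasoning

s₂-suc-double : ∀ m → s₂ (suc (2 ℕ.* m)) ≡ suc (s₂ m)
s₂-suc-double m = begin
  s₂ (1 ℕ.+ 2 ℕ.* m)
    ≡⟨ ≡.cong (λ k → s₂ (1 ℕ.+ k)) (ℕₚ.*-comm 2 m) ⟩
  s₂ (1 ℕ.+ m ℕ.* 2)
    ≡⟨ s₂-step (1 ℕ.+ m ℕ.* 2) ⟩
  (1 ℕ.+ m ℕ.* 2) % 2 ℕ.+ s₂ ((1 ℕ.+ m ℕ.* 2) / 2)
    ≡⟨ ≡.cong₂ (λ b q → b ℕ.+ s₂ q) ([m+kn]%n≡m%n 1 m 2) half ⟩
  1 ℕ.+ s₂ m ∎
  where
  open ≡.≡-Reasoning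
  half : (1 ℕ.+ m ℕ.* 2) / 2 ≡ m
  half = ≡.trans (+-distrib-/-∣ʳ 1 {d = 2} (n∣m*n m)) (m*n/n≡m m 2)

module _ {c ℓ : Level} (R : CommutativeRing c ℓ) where
  open CommutativeRing R
  open import Relation.Binary.Reasoning.Setoid setoid
  open import Algebra.Properties.Ring ring using (-1*x≈-x)
  open import Tactic.RingSolver.NonReflective (ACR.fromCommutativeRing R (λ _ → nothing))
    using (solve; _⊜_; _⊕_; _⊗_; ⊝_)
  private module E = Exp commutativeSemiring

  pow≡^ : ∀ x k → pow R x k ≡ x E.^ k
  pow≡^ x zero    = ≡.refl
  pow≡^ x (suc k) = ≡.cong (x *_) (pow≡^ x k)

  pow-cong : ∀ {x y} k → x ≈ y → pow R x k ≈ pow R y k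
  pow-cong {x} {y} k x≈y = begin
    pow R x k  ≡⟨ pow≡^ x k ⟩
    x E.^ k    ≈⟨ E.^-congˡ k x≈y ⟩
    y E.^ k    ≡⟨ pow≡^ y k ⟨
    pow R y k  ∎

  pow-+ : ∀ x m n → pow R x (m ℕ.+ n) ≈ pow R x m * pow R x n
  pow-+ x m n = begin
    pow R x (m ℕ.+ n)        ≡⟨ pow≡^ x (m ℕ.+ n) ⟩
    x E.^ (m ℕ.+ n)          ≈⟨ E.^-homo-* x m n ⟩
    x E.^ m * x E.^ n        ≡⟨ ≡.cong₂ _*_ (pow≡^ x m) (pow≡^ x n) ⟨
    pow R x m * pow R x n    ∎

  pow-square : ∀ x k → pow R (x * x) k ≈ pow R x (2 ℕ.* k)
  pow-square x k = begin
    pow R (x * x) k      ≡⟨ pow≡^ (x * x) k ⟩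
    (x * x) E.^ k        ≈⟨ E.^-congˡ k (*-congˡ (sym (*-identityʳ x))) ⟩
    (x E.^ 2) E.^ k      ≈⟨ E.^-assocʳ x 2 k ⟩
    x E.^ (2 ℕ.* k)      ≡⟨ pow≡^ x (2 ℕ.* k) ⟨
    pow R x (2 ℕ.* k)    ∎

  root-of-unity-pow-multiple : ∀ {x r} → pow R x r ≈ 1# → ∀ {k} → r ∣ k → pow R x k ≈ 1#
  root-of-unity-pow-multiple {x} {r} xʳ≈1 (divides q ≡.refl) = go q
    where
    go : ∀ q → pow R x (q ℕ.* r) ≈ 1#
    go zero    = refl
    go (suc q) = trans (pow-+ x r (q ℕ.* r)) (trans (*-cong xʳ≈1 (go q)) (*-identityˡ 1#))

  tm-double : ∀ m → tm R (2 ℕ.* m) ≈ tm R m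
  tm-double m = reflexive (≡.cong (pow R (- 1#)) (s₂-double m))

  tm-suc-double : ∀ m → tm R (suc (2 ℕ.* m)) ≈ - tm R m
  tm-suc-double m = trans (reflexive (≡.cong (pow R (- 1#)) (s₂-suc-double m))) (-1*x≈-x (tm R m))

  T-cong : ∀ {x y} n → x ≈ y → T R n x ≈ T R n y
  T-cong zero    x≈y = refl
  T-cong (suc n) x≈y = +-cong (T-cong n x≈y) (*-congˡ (pow-cong n x≈y))

  T-one : ∀ x → T R 1 x ≈ 1#
  T-one x = trans (+-identityˡ _) (*-identityˡ 1#)

  T-double : ∀ m x → T R (2 ℕ.* m) x ≈ (1# - x) * T R m (x * x)
  T-double zero    x = sym (zeroʳ _)
  T-double (suc m) x = begin
    T R (2 ℕ.* suc m) x
      ≡⟨ ≡.cong (λ k → T R k x) (ℕₚ.*-suc 2 m) ⟩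
    (T R (2 ℕ.* m) x + tm R (2 ℕ.* m) * pow R x (2 ℕ.* m)) + tm R (suc (2 ℕ.* m)) * (x * pow R x (2 ℕ.* m))
      ≈⟨ +-cong (+-cong (T-double m x) (*-cong (tm-double m) x²ᵐ≈p))
                (*-cong (tm-suc-double m) (*-congˡ x²ᵐ≈p)) ⟩
    ((1# - x) * A + t * p) + (- t) * (x * p)
      ≈⟨ solve 4 (λ a t x p → (a ⊕ t ⊗ p ⊕ ⊝ t ⊗ (x ⊗ p)) ⊜ (a ⊕ (t ⊗ p ⊕ ⊝ x ⊗ (t ⊗ p))))
               refl ((1# - x) * A) t x p ⟩
    (1# - x) * A + (t * p + (- x) * (t * p))
      ≈⟨ +-congˡ (trans (distribʳ (t * p) 1# (- x)) (+-congʳ (*-identityˡ (t * p)))) ⟨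
    (1# - x) * A + (1# - x) * (t * p)
      ≈⟨ distribˡ (1# - x) A (t * p) ⟨
    (1# - x) * (A + t * p) ∎
    where
    A = T R m (x * x)
    t = tm R m
    p = pow R (x * x) m
    x²ᵐ≈p : pow R x (2 ℕ.* m) ≈ p
    x²ᵐ≈p = sym (pow-square x m)

  T-2^s* : ∀ s m x → T R (2 ^ s ℕ.* m) x ≈ T R (2 ^ s) x * T R m (pow R x (2 ^ s))
  T-2^s* zero m x = begin
    T R (m ℕ.+ 0) x           ≡⟨ ≡.cong (λ k → T R k x) (ℕₚ.+-identityʳ m) ⟩
    T R m x                   ≈⟨ *-identityˡ _ ⟨
    1# * T R m x              ≈⟨ *-cong (T-one x) (T-cong m (*-identityʳ x)) ⟨
    T R 1 x * T R m (x * 1#)  ∎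
  T-2^s* (suc s) m x = begin
    T R (2 ℕ.* 2 ^ s ℕ.* m) x
      ≡⟨ ≡.cong (λ k → T R k x) (ℕₚ.*-assoc 2 (2 ^ s) m) ⟩
    T R (2 ℕ.* (2 ^ s ℕ.* m)) x
      ≈⟨ T-double (2 ^ s ℕ.* m) x ⟩
    (1# - x) * T R (2 ^ s ℕ.* m) (x * x)
      ≈⟨ *-congˡ (T-2^s* s m (x * x)) ⟩
    (1# - x) * (T R (2 ^ s) (x * x) * T R m (pow R (x * x) (2 ^ s)))
      ≈⟨ *-assoc _ _ _ ⟨
    ((1# - x) * T R (2 ^ s) (x * x)) * T R m (pow R (x * x) (2 ^ s))
      ≈⟨ *-cong (T-double (2 ^ s) x) (T-cong m (sym (pow-square x (2 ^ s)))) ⟨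
    T R (2 ℕ.* 2 ^ s) x * T R m (pow R x (2 ℕ.* 2 ^ s)) ∎

proposition3p2 : {c ℓ : Level} (R : CommutativeRing c ℓ) →
    let open CommutativeRing R in
    (r : ℕ) → r % 2 ≡ 1 → r ≥ 1 →
    (ω : Carrier) → pow R ω r ≈ 1# →
    (s : ℕ) → s ≥ 1 → r ∣ (2 ^ s ∸ 1) →
    (n : ℕ) → n ≥ 1 →
    T R (2 ^ s ℕ.* n) ω ≈ T R (2 ^ s) ω * T R n ω
proposition3p2 R r _ _ ω ωʳ≈1 s _ r∣2ˢ-1 n _ = begin
    T R (2 ^ s ℕ.* n) ω                      ≈⟨ T-2^s* R s n ω ⟩
    T R (2 ^ s) ω * T R n (pow R ω (2 ^ s))  ≈⟨ *-congˡ (T-cong R n ω^2ˢ≈ω) ⟩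
    T R (2 ^ s) ω * T R n ω                  ∎
  where
  open CommutativeRing R
  open import Relation.Binary.Reasoning.Setoid setoid
  ω^2ˢ≈ω : pow R ω (2 ^ s) ≈ ω
  ω^2ˢ≈ω = begin
    pow R ω (2 ^ s)          ≡⟨ ≡.cong (pow R ω) (ℕₚ.m+[n∸m]≡n (ℕₚ.m^n>0 2 s)) ⟨
    ω * pow R ω (2 ^ s ∸ 1)  ≈⟨ *-congˡ (root-of-unity-pow-multiple R ωʳ≈1 r∣2ˢ-1) ⟩
    ω * 1#                   ≈⟨ *-identityʳ ω ⟩
    ω                        ∎
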